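{- For positive integers $n$ and $k$, the number of unrestricted Schmidt $k$-partitions of $n$ equals the number of $k$-tuples $(\alpha^1,\ldots,\alpha^k)$ of partitions with $|\alpha^1|+\cdots+|\alpha^k|=n$.
   Context: A partition is a finite weakly decreasing sequence of positive integers (possibly empty); $|\lambda|$ denotes the sum of its parts. An unrestricted Schmidt $k$-partition of $n$ is a partition $(\lambda_1,\lambda_2,\ldots)$ with $\lambda_1\geq\lambda_2\geq\cdots$ and $\lambda_1+\lambda_{k+1}+\lambda_{2k+1}+\cdots=n$. -}

module Defs where

open import Data.Nat using (ℕ; zero; suc; _+_; _∸_; _≥_; _<_)
open import Data.List using (List; []; _∷_)
open import Data.Nat.ListAction using (sum)
open import Data.List.Relation.Unary.All using (All)
open import Data.List.Relation.Unary.Linked using (Linked)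
open import Data.Vec using (Vec)
import Data.Vec as Vec
import Data.Vec.Relation.Unary.All as VAll
open import Data.Product using (Σ; _×_)
open import Relation.Binary.PropositionalEquality using (_≡_)

IsPartition : List ℕ → Set
IsPartition λs = All (0 <_) λs × Linked _≥_ λs

size : List ℕ → ℕ
size = sum

-- everyFrom j c xs : sum of the entries of xs at (0-based) positions
-- c, c + (j+1), c + 2(j+1), ...
everyFrom : ℕ → ℕ → List ℕ → ℕ
everyFrom j c       []       = 0
everyFrom j zero    (x ∷ xs) = x + everyFrom j j xs
everyFrom j (suc c) (x ∷ xs) = everyFrom j c xs

-- Schmidt k-sum: λ₁ + λ_{k+1} + λ_{2k+1} + ⋯  (intended for k ≥ 1)
schmidtSum : ℕ → List ℕ → ℕ
schmidtSum k λs = everyFrom (k ∸ 1) 0 λs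

SchmidtPartition : ℕ → ℕ → Set
SchmidtPartition k n = Σ (List ℕ) λ λs → IsPartition λs × schmidtSum k λs ≡ n

PartitionTuple : ℕ → ℕ → Set
PartitionTuple k n =
  Σ (Vec (List ℕ) k) λ αs → VAll.All IsPartition αs × Vec.sum (Vec.map size αs) ≡ n

{-# OPTIONS --safe #-}
module Submission where

-- A partition λ with at most L parts is the same thing as its vector of
-- differences d ∈ ℕ^L, dᵢ = λᵢ − λᵢ₊₁; then λᵢ = dᵢ + dᵢ₊₁ + ⋯, so
-- |λ| = Σ (i+1) dᵢ and the Schmidt k-sum is Σ (⌊i/k⌋+1) dᵢ. A Schmidt
-- k-partition of n has at most kn parts; dealing its difference vector
-- round-robin into k rows (row r holds d_r, d_{r+k}, d_{r+2k}, …) turns the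
-- Schmidt k-sum into the total size of the k partitions whose difference
-- vectors are these rows. Both sets are thus in bijection with the same
-- decidable subset of the finite set of vectors with entries at most n.

open import Defs
open import Algebra.Properties.CommutativeSemigroup using (interchange)
open import Data.Fin using (Fin; toℕ; fromℕ<) renaming (zero to fzero; suc to fsuc)
open import Data.Fin.Properties using (0↔⊥; 1↔⊤; +↔⊎; toℕ<n; toℕ-fromℕ<; fromℕ<-toℕ)
open import Data.List using (List; []; _∷_; length)
import Data.List as List
import Data.List.Relation.Unary.All as All
open import Data.List.Relation.Unary.All using ([]; _∷_)
import Data.List.Relation.Unary.Linked as Linked
open import Data.List.Relation.Unary.Linked using ([]; [-]; _∷_)
open import Data.Nat using (ℕ; zero; suc; _+_; _*_; _∸_; _≤_; _<_; _≥_; z≤n; s≤s; _≟_)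
open import Data.Nat.Properties
  using ( ≤-trans; ≤-reflexive; ≤-irrelevant; <-irrelevant; ≡-irrelevant
        ; +-mono-≤; +-monoˡ-≤; *-monoʳ-≤; +-assoc; *-comm; *-identityʳ; *-distribˡ-+
        ; m≤m+n; m≤n+m; m+n≤o⇒m≤o; m+n≤o⇒n≤o; m+n≡0⇒m≡0; m+n≡0⇒n≡0; n≤0⇒n≡0
        ; m+n∸n≡m; m∸n+n≡m; +-commutativeSemigroup; module ≤-Reasoning )
open import Data.Product using (Σ; ∃-syntax; _×_; _,_; proj₁; proj₂)
open import Data.Product.Function.Dependent.Propositional using (Σ-↔)
open import Data.Product.Properties using (Σ-≡,≡→≡)
open import Data.Sum using (_⊎_; inj₁; inj₂)
open import Data.Sum.Function.Propositional using (_⊎-↔_)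
open import Data.Vec using (Vec; []; _∷_; _++_; concat; zipWith; transpose; group)
import Data.Vec as Vec
open import Data.Vec.Properties
  using (sum-++; zipWith-is-⊛; transpose-replicate; ++-injectiveˡ; ++-injectiveʳ; map-∘; map-cong; map-id)
import Data.Vec.Relation.Unary.All as VAll
import Data.Vec.Relation.Unary.All.Properties as VAllₚ
open import Function using (_∘_)
open import Function.Bundles using (_↔_; mk↔ₛ′; Inverse)
open import Function.Properties.Inverse using (↔-refl; ↔-sym; ↔-trans)
open import Relation.Binary.PropositionalEquality
  using (_≡_; refl; sym; trans; cong; cong₂; module ≡-Reasoning)
open import Relation.Nullary using (Dec; yes; no; Irrelevant)
open import Relation.Nullary.Decidable using (True-↔)

private
  variable
    A B : Set
    L c m n k j : ℕ

-- Partitions and their difference vectors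

head₀ : List ℕ → ℕ
head₀ []      = 0
head₀ (x ∷ _) = x

infixr 5 _∷⁺_

_∷⁺_ : ℕ → List ℕ → List ℕ
zero  ∷⁺ xs = xs
suc h ∷⁺ xs = suc h ∷ xs

fromDifferences : Vec ℕ L → List ℕ
fromDifferences []       = []
fromDifferences (d ∷ ds) = (d + Vec.sum ds) ∷⁺ fromDifferences ds

differences : ∀ L → List ℕ → Vec ℕ L
differences zero    _        = []
differences (suc L) []       = 0 ∷ differences L []
differences (suc L) (x ∷ xs) = (x ∸ head₀ xs) ∷ differences L xs

head₀-∷⁺ : ∀ h xs → head₀ xs ≤ h → head₀ (h ∷⁺ xs) ≡ h
head₀-∷⁺ zero    xs le = n≤0⇒n≡0 le
head₀-∷⁺ (suc h) xs le = refl

head₀-fromDifferences : (ds : Vec ℕ L) → head₀ (fromDifferences ds) ≡ Vec.sum ds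
head₀-fromDifferences-≤ : ∀ d (ds : Vec ℕ L) → head₀ (fromDifferences ds) ≤ d + Vec.sum ds

head₀-fromDifferences []       = refl
head₀-fromDifferences (d ∷ ds) = head₀-∷⁺ _ _ (head₀-fromDifferences-≤ d ds)

head₀-fromDifferences-≤ d ds = ≤-trans (≤-reflexive (head₀-fromDifferences ds)) (m≤n+m _ d)

fromDifferences-null : (ds : Vec ℕ L) → Vec.sum ds ≡ 0 → fromDifferences ds ≡ []
fromDifferences-null []       _   = refl
fromDifferences-null (d ∷ ds) s≡0 rewrite s≡0 = fromDifferences-null ds (m+n≡0⇒n≡0 d s≡0)

differences-fromDifferences : (ds : Vec ℕ L) → differences L (fromDifferences ds) ≡ ds
differences-fromDifferences [] = refl
differences-fromDifferences {suc L} (d ∷ ds) with d + Vec.sum ds in s≡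
... | zero = begin
  differences (suc L) (fromDifferences ds)  ≡⟨ cong (differences (suc L)) null ⟩
  0 ∷ differences L []                      ≡⟨ cong₂ _∷_ (sym (m+n≡0⇒m≡0 d s≡)) (cong (differences L) (sym null)) ⟩
  d ∷ differences L (fromDifferences ds)    ≡⟨ cong (d ∷_) (differences-fromDifferences ds) ⟩
  d ∷ ds                                    ∎
  where
  open ≡-Reasoning
  null = fromDifferences-null ds (m+n≡0⇒n≡0 d s≡)
... | suc h = cong₂ _∷_ first (differences-fromDifferences ds)
  where
  first : suc h ∸ head₀ (fromDifferences ds) ≡ d
  first = trans (cong₂ _∸_ (sym s≡) (head₀-fromDifferences ds)) (m+n∸n≡m d (Vec.sum ds))

∷⁺-isPartition : ∀ h {xs} → head₀ xs ≤ h → IsPartition xs → IsPartition (h ∷⁺ xs)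
∷⁺-isPartition zero              _   part           = part
∷⁺-isPartition (suc h) {[]}      _   _              = s≤s z≤n ∷ [] , [-]
∷⁺-isPartition (suc h) {x ∷ xs}  x≤h (pos , linked) = s≤s z≤n ∷ pos , x≤h ∷ linked

fromDifferences-isPartition : (ds : Vec ℕ L) → IsPartition (fromDifferences ds)
fromDifferences-isPartition []       = [] , []
fromDifferences-isPartition (d ∷ ds) =
  ∷⁺-isPartition _ (head₀-fromDifferences-≤ d ds) (fromDifferences-isPartition ds)

sum-differences-[] : ∀ L → Vec.sum (differences L []) ≡ 0
sum-differences-[] zero    = refl
sum-differences-[] (suc L) = sum-differences-[] L

head₀-≤ : ∀ {x xs} → Linked.Linked _≥_ (x ∷ xs) → head₀ xs ≤ x
head₀-≤ [-]       = z≤n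
head₀-≤ (x≥y ∷ _) = x≥y

fromDifferences-differences : ∀ xs → IsPartition xs → length xs ≤ L →
                              fromDifferences (differences L xs) ≡ xs
fromDifferences-differences {L} [] _ _ =
  fromDifferences-null (differences L []) (sum-differences-[] L)
fromDifferences-differences {suc L} (suc x ∷ xs) (_ ∷ pos , linked) (s≤s len≤L) =
  cong₂ _∷⁺_ first tail
  where
  tail = fromDifferences-differences xs (pos , Linked.tail linked) len≤L
  first : suc x ∸ head₀ xs + Vec.sum (differences L xs) ≡ suc x
  first = begin
    suc x ∸ head₀ xs + Vec.sum (differences L xs)                ≡⟨ cong (suc x ∸ head₀ xs +_) (sym (head₀-fromDifferences (differences L xs))) ⟩
    suc x ∸ head₀ xs + head₀ (fromDifferences (differences L xs)) ≡⟨ cong (λ ys → suc x ∸ head₀ xs + head₀ ys) tail ⟩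
    suc x ∸ head₀ xs + head₀ xs                                   ≡⟨ m∸n+n≡m (head₀-≤ linked) ⟩
    suc x                                                         ∎
    where open ≡-Reasoning
fromDifferences-differences (zero ∷ xs) (() ∷ _ , _) _

length≤size : ∀ {xs} → All.All (0 <_) xs → length xs ≤ size xs
length≤size []          = z≤n
length≤size (0<x ∷ pos) = +-mono-≤ 0<x (length≤size pos)

length≤everyFrom : ∀ j c {xs} → All.All (0 <_) xs → length xs ≤ c + suc j * everyFrom j c xs
length≤everyFrom j c       []          = z≤n
length≤everyFrom j (suc c) (_ ∷ pos)   = s≤s (length≤everyFrom j c pos)
length≤everyFrom j zero    {x ∷ xs} (0<x ∷ pos) = begin
  suc (length xs)                      ≤⟨ s≤s (length≤everyFrom j j pos) ⟩
  suc j + suc j * everyFrom j j xs     ≤⟨ +-monoˡ-≤ _ (≤-trans (≤-reflexive (sym (*-identityʳ (suc j)))) (*-monoʳ-≤ (suc j) 0<x)) ⟩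
  suc j * x + suc j * everyFrom j j xs ≡⟨ *-distribˡ-+ (suc j) x _ ⟨
  suc j * (x + everyFrom j j xs)       ∎
  where open ≤-Reasoning

×-irrelevant : Irrelevant A → Irrelevant B → Irrelevant (A × B)
×-irrelevant irrA irrB (a , b) (a′ , b′) = cong₂ _,_ (irrA a a′) (irrB b b′)

isPartition-irrelevant : ∀ {xs} → Irrelevant (IsPartition xs)
isPartition-irrelevant = ×-irrelevant (All.irrelevant <-irrelevant) (Linked.irrelevant ≤-irrelevant)

-- Schmidt sums and sizes in terms of difference vectors

suffixSums : Vec ℕ L → List ℕ
suffixSums []       = []
suffixSums (d ∷ ds) = (d + Vec.sum ds) ∷ suffixSums ds

suffixSums-padded : (ds : Vec ℕ L) →
                    ∃[ r ] suffixSums ds ≡ fromDifferences ds List.++ List.replicate r 0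
suffixSums-padded []       = 0 , refl
suffixSums-padded (d ∷ ds) with suffixSums-padded ds | d + Vec.sum ds in s≡
... | r , padded | zero rewrite fromDifferences-null ds (m+n≡0⇒n≡0 d s≡) = suc r , cong (0 ∷_) padded
... | r , padded | suc h = r , cong (suc h ∷_) padded

everyFrom-replicate-0 : ∀ j c r → everyFrom j c (List.replicate r 0) ≡ 0
everyFrom-replicate-0 j c       zero    = refl
everyFrom-replicate-0 j zero    (suc r) = everyFrom-replicate-0 j j r
everyFrom-replicate-0 j (suc c) (suc r) = everyFrom-replicate-0 j c r

everyFrom-++-replicate-0 : ∀ j c xs r → everyFrom j c (xs List.++ List.replicate r 0) ≡ everyFrom j c xs
everyFrom-++-replicate-0 j c       []       r = everyFrom-replicate-0 j c r
everyFrom-++-replicate-0 j zero    (x ∷ xs) r = cong (x +_) (everyFrom-++-replicate-0 j j xs r)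
everyFrom-++-replicate-0 j (suc c) (x ∷ xs) r = everyFrom-++-replicate-0 j c xs r

everyFrom-fromDifferences : ∀ j c (ds : Vec ℕ L) →
                            everyFrom j c (fromDifferences ds) ≡ everyFrom j c (suffixSums ds)
everyFrom-fromDifferences j c ds with suffixSums-padded ds
... | r , padded = sym (trans (cong (everyFrom j c) padded) (everyFrom-++-replicate-0 j c (fromDifferences ds) r))

everyFrom-suffixSums-++ : ∀ j (xs : Vec ℕ c) (ys : Vec ℕ m) →
                          everyFrom j c (suffixSums (xs ++ ys)) ≡ everyFrom j 0 (suffixSums ys)
everyFrom-suffixSums-++ j []       ys = refl
everyFrom-suffixSums-++ j (x ∷ xs) ys = everyFrom-suffixSums-++ j xs ys

size-∷⁺ : ∀ h xs → size (h ∷⁺ xs) ≡ h + size xs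
size-∷⁺ zero    xs = refl
size-∷⁺ (suc h) xs = refl

weight : Vec (Vec ℕ n) k → ℕ
weight M = Vec.sum (Vec.map size (Vec.map fromDifferences M))

total : Vec (Vec ℕ n) k → ℕ
total M = Vec.sum (Vec.map Vec.sum M)

weight-replicate-[] : ∀ k → weight (Vec.replicate k []) ≡ 0
weight-replicate-[] zero    = refl
weight-replicate-[] (suc k) = weight-replicate-[] k

total-replicate-[] : ∀ k → total (Vec.replicate k []) ≡ 0
total-replicate-[] zero    = refl
total-replicate-[] (suc k) = total-replicate-[] k

total-zipWith-∷ : (b : Vec ℕ k) (M : Vec (Vec ℕ n) k) → total (zipWith _∷_ b M) ≡ Vec.sum b + total M
total-zipWith-∷ []      []      = refl
total-zipWith-∷ (x ∷ b) (m ∷ M) = begin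
  x + Vec.sum m + total (zipWith _∷_ b M)    ≡⟨ cong (x + Vec.sum m +_) (total-zipWith-∷ b M) ⟩
  x + Vec.sum m + (Vec.sum b + total M)      ≡⟨ interchange +-commutativeSemigroup x _ _ _ ⟩
  x + Vec.sum b + (Vec.sum m + total M)      ∎
  where open ≡-Reasoning

weight-zipWith-∷ : (b : Vec ℕ k) (M : Vec (Vec ℕ n) k) →
                   weight (zipWith _∷_ b M) ≡ Vec.sum b + total M + weight M
weight-zipWith-∷ []      []      = refl
weight-zipWith-∷ (x ∷ b) (m ∷ M) = begin
  size (fromDifferences (x ∷ m)) + weight (zipWith _∷_ b M)
    ≡⟨ cong₂ _+_ (size-∷⁺ (x + Vec.sum m) _) (weight-zipWith-∷ b M) ⟩
  (x + Vec.sum m + size (fromDifferences m)) + (Vec.sum b + total M + weight M)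
    ≡⟨ interchange +-commutativeSemigroup (x + Vec.sum m) _ _ _ ⟩
  (x + Vec.sum m + (Vec.sum b + total M)) + (size (fromDifferences m) + weight M)
    ≡⟨ cong (_+ (size (fromDifferences m) + weight M)) (interchange +-commutativeSemigroup x _ _ _) ⟩
  (x + Vec.sum b + (Vec.sum m + total M)) + (size (fromDifferences m) + weight M)
    ∎
  where open ≡-Reasoning

-- Dealing a vector into rows

transpose-∷ : (b : Vec A k) (bs : Vec (Vec A k) n) → transpose (b ∷ bs) ≡ zipWith _∷_ b (transpose bs)
transpose-∷ b bs = sym (zipWith-is-⊛ _∷_ b (transpose bs))

transpose-zipWith-∷ : (b : Vec A k) (M : Vec (Vec A n) k) → transpose (zipWith _∷_ b M) ≡ b ∷ transpose M
transpose-zipWith-∷ []      []      = refl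
transpose-zipWith-∷ (x ∷ b) (m ∷ M) = begin
  transpose ((x ∷ m) ∷ zipWith _∷_ b M)              ≡⟨ transpose-∷ (x ∷ m) (zipWith _∷_ b M) ⟩
  zipWith _∷_ (x ∷ m) (transpose (zipWith _∷_ b M))  ≡⟨ cong (zipWith _∷_ (x ∷ m)) (transpose-zipWith-∷ b M) ⟩
  (x ∷ b) ∷ zipWith _∷_ m (transpose M)              ≡⟨ cong ((x ∷ b) ∷_) (transpose-∷ m M) ⟨
  (x ∷ b) ∷ transpose (m ∷ M)                        ∎
  where open ≡-Reasoning

transpose-involutive : (M : Vec (Vec A k) n) → transpose (transpose M) ≡ M
transpose-involutive []       = transpose-replicate []
transpose-involutive (b ∷ bs) = begin
  transpose (transpose (b ∷ bs))            ≡⟨ cong transpose (transpose-∷ b bs) ⟩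
  transpose (zipWith _∷_ b (transpose bs))  ≡⟨ transpose-zipWith-∷ b (transpose bs) ⟩
  b ∷ transpose (transpose bs)              ≡⟨ cong (b ∷_) (transpose-involutive bs) ⟩
  b ∷ bs                                    ∎
  where open ≡-Reasoning

total-transpose : (bs : Vec (Vec ℕ k) n) → total (transpose bs) ≡ Vec.sum (concat bs)
total-transpose {k} []    = total-replicate-[] k
total-transpose (b ∷ bs) = begin
  total (transpose (b ∷ bs))               ≡⟨ cong total (transpose-∷ b bs) ⟩
  total (zipWith _∷_ b (transpose bs))     ≡⟨ total-zipWith-∷ b (transpose bs) ⟩
  Vec.sum b + total (transpose bs)         ≡⟨ cong (Vec.sum b +_) (total-transpose bs) ⟩
  Vec.sum b + Vec.sum (concat bs)          ≡⟨ sum-++ b ⟨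
  Vec.sum (b ++ concat bs)                 ∎
  where open ≡-Reasoning

concat-injective : (xss yss : Vec (Vec A k) n) → concat xss ≡ concat yss → xss ≡ yss
concat-injective []         []         _  = refl
concat-injective (xs ∷ xss) (ys ∷ yss) eq =
  cong₂ _∷_ (++-injectiveˡ xs ys eq) (concat-injective xss yss (++-injectiveʳ xs ys eq))

chunks : ∀ n k → Vec A (n * k) → Vec (Vec A k) n
chunks n k v = proj₁ (group n k v)

concat-chunks : ∀ n k (v : Vec A (n * k)) → concat (chunks n k v) ≡ v
concat-chunks n k v = sym (proj₂ (group n k v))

chunks-concat : ∀ n k (xss : Vec (Vec A k) n) → chunks n k (concat xss) ≡ xss
chunks-concat n k xss = concat-injective _ _ (concat-chunks n k (concat xss))

-- Row r of deal n k v is (v_r, v_{r+k}, v_{r+2k}, …).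
deal : ∀ n k → Vec A (n * k) → Vec (Vec A n) k
deal n k = transpose ∘ chunks n k

deal-↔ : ∀ n k → Vec A (n * k) ↔ Vec (Vec A n) k
deal-↔ n k = mk↔ₛ′ (deal n k) (concat ∘ transpose)
  (λ M → trans (cong transpose (chunks-concat n k (transpose M))) (transpose-involutive M))
  (λ v → trans (cong concat (transpose-involutive (chunks n k v))) (concat-chunks n k v))

everyFrom-suffixSums-concat : (bs : Vec (Vec ℕ (suc j)) n) →
                              everyFrom j 0 (suffixSums (concat bs)) ≡ weight (transpose bs)
everyFrom-suffixSums-concat {j} []                = sym (weight-replicate-[] (suc j))
everyFrom-suffixSums-concat {j} ((x ∷ xs) ∷ bs) = begin
  x + Vec.sum (xs ++ concat bs) + everyFrom j j (suffixSums (xs ++ concat bs))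
    ≡⟨ cong₂ _+_ (cong (x +_) (sum-++ xs)) (everyFrom-suffixSums-++ j xs (concat bs)) ⟩
  x + (Vec.sum xs + Vec.sum (concat bs)) + everyFrom j 0 (suffixSums (concat bs))
    ≡⟨ cong₂ _+_ (trans (sym (+-assoc x _ _)) (cong (x + Vec.sum xs +_) (sym (total-transpose bs))))
                 (everyFrom-suffixSums-concat bs) ⟩
  Vec.sum (x ∷ xs) + total (transpose bs) + weight (transpose bs)
    ≡⟨ weight-zipWith-∷ (x ∷ xs) (transpose bs) ⟨
  weight (zipWith _∷_ (x ∷ xs) (transpose bs))
    ≡⟨ cong weight (transpose-∷ (x ∷ xs) bs) ⟨
  weight (transpose ((x ∷ xs) ∷ bs))
    ∎
  where open ≡-Reasoning

schmidtSum-fromDifferences : ∀ n j (v : Vec ℕ (n * suc j)) →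
                             schmidtSum (suc j) (fromDifferences v) ≡ weight (deal n (suc j) v)
schmidtSum-fromDifferences n j v = begin
  everyFrom j 0 (fromDifferences v)                         ≡⟨ everyFrom-fromDifferences j 0 v ⟩
  everyFrom j 0 (suffixSums v)                              ≡⟨ cong (everyFrom j 0 ∘ suffixSums) (concat-chunks n (suc j) v) ⟨
  everyFrom j 0 (suffixSums (concat (chunks n (suc j) v)))  ≡⟨ everyFrom-suffixSums-concat (chunks n (suc j) v) ⟩
  weight (deal n (suc j) v)                                 ∎
  where open ≡-Reasoning

restrict-↔ : {P : A → Set} {Q : B → Set} →
             (∀ {a} → Irrelevant (P a)) → (∀ {b} → Irrelevant (Q b)) →
             (f : A → B) (g : B → A) →
             (∀ {a} → P a → Q (f a)) → (∀ {b} → Q b → P (g b)) →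
             (∀ {a} → P a → g (f a) ≡ a) → (∀ {b} → Q b → f (g b) ≡ b) →
             Σ A P ↔ Σ B Q
restrict-↔ irrP irrQ f g f-Q g-P gf fg = mk↔ₛ′
  (λ (a , p) → f a , f-Q p)
  (λ (b , q) → g b , g-P q)
  (λ (b , q) → Σ-≡,≡→≡ (fg q , irrQ _ _))
  (λ (a , p) → Σ-≡,≡→≡ (gf p , irrP _ _))

≡-cong-↔ : {a b n : ℕ} → a ≡ b → (a ≡ n) ↔ (b ≡ n)
≡-cong-↔ refl = ↔-refl

SchmidtDifferences : ℕ → ℕ → Set
SchmidtDifferences k n = Σ (Vec ℕ (n * k)) λ v → schmidtSum k (fromDifferences v) ≡ n

DifferenceTuple : ℕ → ℕ → Set
DifferenceTuple k n = Σ (Vec (Vec ℕ n) k) λ M → weight M ≡ n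

SchmidtPartition↔SchmidtDifferences : ∀ j n → SchmidtPartition (suc j) n ↔ SchmidtDifferences (suc j) n
SchmidtPartition↔SchmidtDifferences j n =
  restrict-↔ (×-irrelevant isPartition-irrelevant ≡-irrelevant) ≡-irrelevant
    (differences (n * suc j)) fromDifferences
    (λ (part , s≡n) → trans (cong (schmidtSum (suc j)) (round-trip part s≡n)) s≡n)
    (λ {v} s≡n → fromDifferences-isPartition v , s≡n)
    (λ (part , s≡n) → round-trip part s≡n)
    (λ {v} _ → differences-fromDifferences v)
  where
  round-trip : ∀ {xs} → IsPartition xs → schmidtSum (suc j) xs ≡ n →
               fromDifferences (differences (n * suc j) xs) ≡ xs
  round-trip {xs} part s≡n = fromDifferences-differences xs part (begin
    length xs                ≤⟨ length≤everyFrom j 0 (proj₁ part) ⟩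
    suc j * everyFrom j 0 xs ≡⟨ cong (suc j *_) s≡n ⟩
    suc j * n                ≡⟨ *-comm (suc j) n ⟩
    n * suc j                ∎)
    where open ≤-Reasoning

SchmidtDifferences↔DifferenceTuple : ∀ j n → SchmidtDifferences (suc j) n ↔ DifferenceTuple (suc j) n
SchmidtDifferences↔DifferenceTuple j n =
  Σ-↔ (deal-↔ n (suc j)) λ {v} → ≡-cong-↔ (schmidtSum-fromDifferences n j v)

map-fromDifferences-differences : (αs : Vec (List ℕ) k) → VAll.All IsPartition αs →
                                  Vec.sum (Vec.map size αs) ≤ L →
                                  Vec.map fromDifferences (Vec.map (differences L) αs) ≡ αs
map-fromDifferences-differences []       VAll.[]             _  = refl
map-fromDifferences-differences (α ∷ αs) (part VAll.∷ parts) le = cong₂ _∷_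
  (fromDifferences-differences α part (≤-trans (length≤size (proj₁ part)) (m+n≤o⇒m≤o (size α) le)))
  (map-fromDifferences-differences αs parts (m+n≤o⇒n≤o (size α) le))

PartitionTuple↔DifferenceTuple : ∀ k n → PartitionTuple k n ↔ DifferenceTuple k n
PartitionTuple↔DifferenceTuple k n =
  restrict-↔ (×-irrelevant (VAll.irrelevant isPartition-irrelevant) ≡-irrelevant) ≡-irrelevant
    (Vec.map (differences n)) (Vec.map fromDifferences)
    (λ (parts , s≡n) → trans (cong (Vec.sum ∘ Vec.map size) (round-trip parts s≡n)) s≡n)
    (λ {M} s≡n → VAllₚ.map⁺ (VAll.universal fromDifferences-isPartition M) , s≡n)
    (λ (parts , s≡n) → round-trip parts s≡n)
    (λ {M} _ → begin
      Vec.map (differences n) (Vec.map fromDifferences M) ≡⟨ map-∘ (differences n) fromDifferences M ⟨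
      Vec.map (differences n ∘ fromDifferences) M        ≡⟨ map-cong differences-fromDifferences M ⟩
      Vec.map (λ ds → ds) M                              ≡⟨ map-id M ⟩
      M                                                  ∎)
  where
  open ≡-Reasoning
  round-trip : ∀ {αs} → VAll.All IsPartition αs → Vec.sum (Vec.map size αs) ≡ n →
               Vec.map fromDifferences (Vec.map (differences n) αs) ≡ αs
  round-trip {αs} parts s≡n = map-fromDifferences-differences αs parts (≤-reflexive s≡n)

-- Finiteness

Finite : Set → Set
Finite X = Σ ℕ λ m → Fin m ↔ X

finite-Dec : Dec A → Irrelevant A → Finite A
finite-Dec a?@(yes _) irr = 1 , ↔-trans 1↔⊤ (True-↔ a? irr)
finite-Dec a?@(no _)  irr = 0 , ↔-trans 0↔⊥ (True-↔ a? irr)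

Σ-Fin-suc-↔ : (Q : Fin (suc m) → Set) → (Q fzero ⊎ Σ (Fin m) (Q ∘ fsuc)) ↔ Σ (Fin (suc m)) Q
Σ-Fin-suc-↔ Q = mk↔ₛ′
  (λ { (inj₁ q) → fzero , q ; (inj₂ (i , q)) → fsuc i , q })
  (λ { (fzero , q) → inj₁ q ; (fsuc i , q) → inj₂ (i , q) })
  (λ { (fzero , q) → refl ; (fsuc i , q) → refl })
  (λ { (inj₁ q) → refl ; (inj₂ (i , q)) → refl })

finite-Σ-Fin : ∀ m {Q : Fin m → Set} → (∀ i → Finite (Q i)) → Finite (Σ (Fin m) Q)
finite-Σ-Fin zero    _   = 0 , mk↔ₛ′ (λ ()) (λ { (() , _) }) (λ { (() , _) }) (λ ())
finite-Σ-Fin (suc m) {Q} fin with fin fzero | finite-Σ-Fin m (fin ∘ fsuc)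
... | a , eq₀ | b , eq₊ = a + b , ↔-trans +↔⊎ (↔-trans (eq₀ ⊎-↔ eq₊) (Σ-Fin-suc-↔ Q))

finite-Σ : {P : A → Set} → Finite A → (∀ a → Finite (P a)) → Finite (Σ A P)
finite-Σ (m , e) fin with finite-Σ-Fin m (fin ∘ Inverse.to e)
... | m′ , e′ = m′ , ↔-trans e′ (Σ-↔ e ↔-refl)

Fin↔< : ∀ b → Fin b ↔ Σ ℕ (_< b)
Fin↔< b = mk↔ₛ′ (λ i → toℕ i , toℕ<n i) (λ (x , x<b) → fromℕ< x<b)
  (λ (x , x<b) → Σ-≡,≡→≡ (toℕ-fromℕ< x<b , <-irrelevant _ _))
  (λ i → fromℕ<-toℕ i (toℕ<n i))

∷-All-↔ : {P : A → Set} → (Σ A P × Σ (Vec A L) (VAll.All P)) ↔ Σ (Vec A (suc L)) (VAll.All P)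
∷-All-↔ = mk↔ₛ′
  (λ ((x , px) , (xs , pxs)) → x ∷ xs , px VAll.∷ pxs)
  (λ { (x ∷ xs , px VAll.∷ pxs) → (x , px) , (xs , pxs) })
  (λ { (x ∷ xs , px VAll.∷ pxs) → refl })
  (λ ((x , px) , (xs , pxs)) → refl)

finite-bounded : ∀ b L → Finite (Σ (Vec ℕ L) (VAll.All (_< b)))
finite-bounded b zero    = 1 , mk↔ₛ′ (λ _ → [] , VAll.[]) (λ _ → fzero)
  (λ { ([] , VAll.[]) → refl }) (λ { fzero → refl ; (fsuc ()) })
finite-bounded b (suc L) with finite-Σ (b , Fin↔< b) (λ _ → finite-bounded b L)
... | m , e = m , ↔-trans e ∷-All-↔

finite-bounded-subset : ∀ b L {P : Vec ℕ L → Set} →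
                        (∀ v → Dec (P v)) → (∀ {v} → Irrelevant (P v)) →
                        (∀ v → P v → VAll.All (_< b) v) → Finite (Σ (Vec ℕ L) P)
finite-bounded-subset b L {P} P? irr bounded
  with finite-Σ (finite-bounded b L) (λ (v , _) → finite-Dec (P? v) irr)
... | m , e = m , ↔-trans e forget-bound
  where
  forget-bound : Σ (Σ (Vec ℕ L) (VAll.All (_< b))) (P ∘ proj₁) ↔ Σ (Vec ℕ L) P
  forget-bound = mk↔ₛ′ (λ ((v , _) , p) → v , p) (λ (v , p) → (v , bounded v p) , p) (λ _ → refl)
    (λ ((v , v<b) , p) → cong (λ v<b′ → (v , v<b′) , p) (VAll.irrelevant <-irrelevant _ _))

head₀≤everyFrom : ∀ j xs → head₀ xs ≤ everyFrom j 0 xs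
head₀≤everyFrom j []       = z≤n
head₀≤everyFrom j (x ∷ xs) = m≤m+n x _

sum<⇒All< : ∀ {b} (v : Vec ℕ L) → Vec.sum v < b → VAll.All (_< b) v
sum<⇒All< []      _   = VAll.[]
sum<⇒All< (x ∷ v) s<b =
  m+n≤o⇒m≤o (suc x) s<b VAll.∷ sum<⇒All< v (≤-trans (s≤s (m≤n+m (Vec.sum v) x)) s<b)

SchmidtDifferences-finite : ∀ j n → Finite (SchmidtDifferences (suc j) n)
SchmidtDifferences-finite j n =
  finite-bounded-subset (suc n) (n * suc j) (λ v → _ ≟ n) ≡-irrelevant entries≤n
  where
  entries≤n : ∀ v → schmidtSum (suc j) (fromDifferences v) ≡ n → VAll.All (_< suc n) v
  entries≤n v s≡n = sum<⇒All< v (s≤s (begin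
    Vec.sum v                          ≡⟨ head₀-fromDifferences v ⟨
    head₀ (fromDifferences v)          ≤⟨ head₀≤everyFrom j (fromDifferences v) ⟩
    everyFrom j 0 (fromDifferences v)  ≡⟨ s≡n ⟩
    n                                  ∎))
    where open ≤-Reasoning

corollary3 : (n k : ℕ) → 1 ≤ n → 1 ≤ k →
    Σ ℕ (λ m → (Fin m ↔ SchmidtPartition k n) × (Fin m ↔ PartitionTuple k n))
corollary3 n zero    _ ()
corollary3 n (suc j) _ _ with SchmidtDifferences-finite j n
... | m , enumeration =
  m , ↔-trans enumeration (↔-sym (SchmidtPartition↔SchmidtDifferences j n))
    , ↔-trans enumeration (↔-trans (SchmidtDifferences↔DifferenceTuple j n)
                                    (↔-sym (PartitionTuple↔DifferenceTuple (suc j) n)))
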